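{- For all $n\geq1$, $$\sum_{i=1}^{n}B_{i}^{neobc}=\frac{21B_{n}^{2}-3B_{n}B_{n+1}+3B_{2n}+3n}{4},\quad \sum_{i=1}^{n}C_{i}^{neobc}=15B_{n}^{2}-3B_{n}B_{n+1}+3B_{2n},$$ $$\sum_{i=1}^{n}R_{i}^{neobc}=\frac{9B_{n}^{2}-3B_{n}B_{n+1}+3B_{2n}-5n}{4},\quad \sum_{i=1}^{n}CR_{i}^{neobc}=3B_{n}^{2},$$ where $B_k$ are the balancing numbers.
   Context: Balancing numbers: $B_0=0$, $B_1=1$, $B_k=6B_{k-1}-B_{k-2}$. A positive integer $m$ is a neo balcobalancing number if there is a positive integer $r$ (its neo balcobalancer) such that $(1+2+\cdots+(m-1))+(1+2+\cdots+m)=2[(m-1)+m+(m+1)+(m+2)+\cdots+(m+r)]$; then $r=\frac{ -2m-1+\sqrt{8m^2-12m+9}}{2}$ (equivalently, $m$ is a neo balcobalancing number iff $8m^2-12m+9$ is a perfect square). $B_n^{neobc}$ denotes the $n$-th neo balcobalancing number in increasing order ($n\ge1$), $R_n^{neobc}$ its neo balcobalancer, $C_n^{neobc}=\sqrt{8(B_n^{neobc})^2-12B_n^{neobc}+9}$ and $CR_n^{neobc}=\sqrt{2(R_n^{neobc})^2+5R_n^{neobc}+2}$. -}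

module Defs where

open import Data.Nat using (ℕ; zero; suc; _+_; _*_; _∸_; _<_; _≤_; _≤ᵇ_; _/_)
open import Data.Bool using (if_then_else_)
open import Data.Product using (Σ; ∃; _×_; _,_)
open import Function.Bundles using (_⇔_)
open import Relation.Binary.PropositionalEquality using (_≡_)

-- Balancing numbers: B 0 = 0, B 1 = 1, B (k+2) = 6 B (k+1) - B k
-- (the sequence is increasing, so truncated subtraction is exact).
B : ℕ → ℕ
B zero = 0
B (suc zero) = 1
B (suc (suc k)) = 6 * B (suc k) ∸ B k

sum0 : (ℕ → ℕ) → ℕ → ℕ
sum0 f zero = 0
sum0 f (suc n) = sum0 f n + f n

sum1 : (ℕ → ℕ) → ℕ → ℕ
sum1 f n = sum0 (λ k → f (suc k)) n

NeoBalcoEq : ℕ → ℕ → Set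
NeoBalcoEq m r =
  sum1 (λ i → i) (m ∸ 1) + sum1 (λ i → i) m ≡ 2 * sum0 (λ k → (m ∸ 1) + k) (r + 2)

NeoBC : ℕ → Set
NeoBC m = 1 ≤ m × Σ ℕ (λ r → 1 ≤ r × NeoBalcoEq m r)

-- e enumerates the neo balcobalancing numbers in increasing order:
-- e 1 < e 2 < e 3 < ... and {e n | n ≥ 1} is exactly the set of neo balcobalancing numbers.
-- (e 0 is unused.)  Such e is unique, so e n is B_n^{neobc}.
IsNeoBCEnum : (ℕ → ℕ) → Set
IsNeoBCEnum e =
  ((i : ℕ) → e (suc i) < e (suc (suc i))) ×
  ((m : ℕ) → NeoBC m ⇔ Σ ℕ (λ i → e (suc i) ≡ m))

isqrt : ℕ → ℕ
isqrt zero = 0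
isqrt (suc n) = let k = isqrt n in
  if (suc k * suc k) ≤ᵇ suc n then suc k else k

-- C(m) = sqrt(8m^2 - 12m + 9)   (8m^2 + 9 ≥ 12m always)
Cval : ℕ → ℕ
Cval m = isqrt (8 * m * m + 9 ∸ 12 * m)

Rval : ℕ → ℕ
Rval m = (Cval m ∸ (2 * m + 1)) / 2

CRval : ℕ → ℕ
CRval r = isqrt (2 * r * r + 5 * r + 2)

module Submission where

-- Put x = 4 m − 3 and C = 2 r + 2 m + 1. Then m is a neo balcobalancing number with balancer r
-- exactly when C² = 8 m² − 12 m + 9, i.e. x² − 2 C² = −9. The automorphism
-- (x , C) ↦ (17 x + 24 C , 12 x + 17 C) of this Pell-type equation preserves x mod 4 and increases m,
-- and a descent along its inverse shows that every solution comes from the trivial one m = 0, C = 3.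
-- Along this orbit m, r, C and CR are 6 B_n (B_n − B_{n−1}), 12 B_{n−1} B_n + 1, 2 r + 2 m + 1 and
-- 3 (B_n² − B_{n−1}²), so each sum telescopes, every step being a polynomial identity modulo
-- B_{n+1}² − 6 B_n B_{n+1} + B_n² = 1; B_{2n} = 2 B_n B_{n+1} − 6 B_n² then gives the stated form.
-- The orbit lists the neo balcobalancing numbers increasingly, so it is the enumeration B_n^{neobc}.

open import Defs

module Squares where
  open import Data.Bool using (true; false; T)
  open import Data.Nat
  open import Data.Nat.Properties
  open import Data.Product using (_×_; _,_; proj₁; proj₂)
  open import Data.Unit using (tt)
  open import Relation.Binary.PropositionalEquality
  open import Relation.Nullary using (yes; no; contradiction)

  square-≤⇒≤ : ∀ a b → a * a ≤ b * b → a ≤ b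
  square-≤⇒≤ a b a²≤b² with a ≤? b
  ... | yes a≤b = a≤b
  ... | no  a≰b = let b<a = ≰⇒> a≰b in contradiction a²≤b² (<⇒≱ (*-mono-< b<a b<a))

  square-<⇒< : ∀ a b → a * a < b * b → a < b
  square-<⇒< a b a²<b² with a <? b
  ... | yes a<b = a<b
  ... | no  a≮b = let b≤a = ≮⇒≥ a≮b in contradiction (*-mono-≤ b≤a b≤a) (<⇒≱ a²<b²)

  square-injective : ∀ a b → a * a ≡ b * b → a ≡ b
  square-injective a b a²≡b² =
    ≤-antisym (square-≤⇒≤ a b (≤-reflexive a²≡b²)) (square-≤⇒≤ b a (≤-reflexive (sym a²≡b²)))

  not-square : ∀ a c {n} → T (a * a <ᵇ n) → T (n <ᵇ suc a * suc a) → c * c ≢ n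
  not-square a c above below refl = <⇒≱ (square-<⇒< a c (<ᵇ⇒< (a * a) (c * c) above))
    (s≤s⁻¹ (square-<⇒< c (suc a) (<ᵇ⇒< (c * c) (suc a * suc a) below)))

  isqrt-bounds : ∀ n → isqrt n * isqrt n ≤ n × n < suc (isqrt n) * suc (isqrt n)
  isqrt-bounds zero = z≤n , s≤s z≤n
  isqrt-bounds (suc n) with isqrt-bounds n
  ... | lower , upper with suc (isqrt n) * suc (isqrt n) ≤ᵇ suc n in grows
  ... | true  = ≤ᵇ⇒≤ _ _ (subst T (sym grows) tt)
              , <-≤-trans (s≤s upper) (*-mono-< (n<1+n (suc (isqrt n))) (n<1+n (suc (isqrt n))))
  ... | false = m≤n⇒m≤1+n lower , ≰⇒> (λ le → subst T grows (≤⇒≤ᵇ le))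

  isqrt-square : ∀ k → isqrt (k * k) ≡ k
  isqrt-square k = ≤-antisym (square-≤⇒≤ (isqrt (k * k)) k (proj₁ (isqrt-bounds (k * k))))
                             (s≤s⁻¹ (square-<⇒< k (suc (isqrt (k * k))) (proj₂ (isqrt-bounds (k * k)))))

module BalancingNumbers where
  open import Data.Integer using (ℤ; +_; _+_; _-_; _*_)
  import Data.Integer.Properties as ℤ
  open import Data.Integer.Tactic.RingSolver using (solve-∀)
  open import Data.Nat as ℕ using (ℕ; zero; suc; _≤_; _∸_)
  import Data.Nat.Properties as ℕ
  open import Data.Product using (_×_; _,_; proj₁; proj₂)
  open import Relation.Binary.PropositionalEquality

  pos-∸ : ∀ {a b} → a ≤ b → + (b ∸ a) ≡ + b - + a
  pos-∸ {a} {b} a≤b = sym (trans (ℤ.m-n≡m⊖n b a) (ℤ.⊖-≥ a≤b))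

  pos-lin : ∀ a x b y → + (a ℕ.* x ℕ.+ b ℕ.* y) ≡ + a * + x + + b * + y
  pos-lin a x b y = trans (ℤ.pos-+ (a ℕ.* x) (b ℕ.* y)) (cong₂ _+_ (ℤ.pos-* a x) (ℤ.pos-* b y))

  B-mono : ∀ k → B k ≤ B (suc k)
  B-mono zero = ℕ.z≤n
  B-mono (suc zero) = ℕ.s≤s ℕ.z≤n
  B-mono (suc (suc k)) = let b = B (suc (suc k)) in begin
    b                   ≤⟨ ℕ.m≤n*m b 5 ⟩
    5 ℕ.* b             ≡⟨ ℕ.m+n∸m≡n b (5 ℕ.* b) ⟨
    6 ℕ.* b ∸ b         ≤⟨ ℕ.∸-monoʳ-≤ (6 ℕ.* b) (B-mono (suc k)) ⟩
    6 ℕ.* b ∸ B (suc k) ∎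
    where open ℕ.≤-Reasoning

  B-next : ∀ k → + B (suc (suc k)) ≡ + 6 * + B (suc k) - + B k
  B-next k = trans (pos-∸ (ℕ.≤-trans (B-mono k) (ℕ.m≤n*m (B (suc k)) 6)))
                   (cong (_- + B k) (ℤ.pos-* 6 (B (suc k))))

  -- Every identity between balancing numbers below is a polynomial identity modulo
  -- cassini (B k) (B (k + 1)) = 0. The solver cannot unfold cassini, so such identities
  -- are stated with it written out.
  cassini : ℤ → ℤ → ℤ
  cassini P Q = Q * Q + P * P - (+ 6 * P * Q + + 1)

  B-cassini : ∀ k → cassini (+ B k) (+ B (suc k)) ≡ + 0
  B-cassini zero = refl
  B-cassini (suc k) = begin
    cassini Q (+ B (suc (suc k))) ≡⟨ cong (cassini Q) (B-next k) ⟩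
    cassini Q (+ 6 * Q - P)       ≡⟨ invariant P Q ⟩
    cassini P Q                   ≡⟨ B-cassini k ⟩
    + 0                           ∎
    where
    open ≡-Reasoning
    P = + B k
    Q = + B (suc k)
    invariant : ∀ P Q → (+ 6 * Q - P) * (+ 6 * Q - P) + Q * Q - (+ 6 * Q * (+ 6 * Q - P) + + 1)
                      ≡ Q * Q + P * P - (+ 6 * P * Q + + 1)
    invariant = solve-∀

  ≡-by-cassini : ∀ {L R} K k → L - R ≡ K * cassini (+ B k) (+ B (suc k)) → L ≡ R
  ≡-by-cassini {L} {R} K k L-R = ℤ.i-j≡0⇒i≡j L R
    (trans L-R (trans (cong (K *_) (B-cassini k)) (ℤ.*-zeroʳ K)))

  B-double : ∀ n → + B (2 ℕ.* n) ≡ + 2 * + B n * + B (suc n) - + 6 * + B n * + B n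
  B-double n = trans (cong (λ i → + B i) (ℕ.*-comm 2 n)) (proj₁ (B-double-and-next n))
    where
    B-double-and-next : ∀ n → + B (n ℕ.* 2) ≡ + 2 * + B n * + B (suc n) - + 6 * + B n * + B n
                            × + B (suc (n ℕ.* 2)) ≡ + B (suc n) * + B (suc n) - + B n * + B n
    B-double-and-next zero = refl , refl
    B-double-and-next (suc n) = trans even′ (cong (λ x → + 2 * Q * x - + 6 * Q * Q) (sym (B-next n))) , odd
      where
      open ≡-Reasoning
      P = + B n
      Q = + B (suc n)
      ih = B-double-and-next n
      even-identity : ∀ P Q → + 6 * (Q * Q - P * P) - (+ 2 * P * Q - + 6 * P * P)
                            ≡ + 2 * Q * (+ 6 * Q - P) - + 6 * Q * Q
      even-identity = solve-∀
      odd-identity : ∀ P Q → + 6 * (+ 2 * Q * (+ 6 * Q - P) - + 6 * Q * Q) - (Q * Q - P * P)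
                           ≡ (+ 6 * Q - P) * (+ 6 * Q - P) - Q * Q
      odd-identity = solve-∀
      even′ : + B (suc (suc (n ℕ.* 2))) ≡ + 2 * Q * (+ 6 * Q - P) - + 6 * Q * Q
      even′ = begin
        + B (suc (suc (n ℕ.* 2)))                           ≡⟨ B-next (n ℕ.* 2) ⟩
        + 6 * + B (suc (n ℕ.* 2)) - + B (n ℕ.* 2)
          ≡⟨ cong₂ (λ u v → + 6 * u - v) (proj₂ ih) (proj₁ ih) ⟩
        + 6 * (Q * Q - P * P) - (+ 2 * P * Q - + 6 * P * P) ≡⟨ even-identity P Q ⟩
        + 2 * Q * (+ 6 * Q - P) - + 6 * Q * Q               ∎
      odd : + B (suc (suc (suc (n ℕ.* 2)))) ≡ + B (suc (suc n)) * + B (suc (suc n)) - Q * Q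
      odd = begin
        + B (suc (suc (suc (n ℕ.* 2))))                                 ≡⟨ B-next (suc (n ℕ.* 2)) ⟩
        + 6 * + B (suc (suc (n ℕ.* 2))) - + B (suc (n ℕ.* 2))
          ≡⟨ cong₂ (λ u v → + 6 * u - v) even′ (proj₂ ih) ⟩
        + 6 * (+ 2 * Q * (+ 6 * Q - P) - + 6 * Q * Q) - (Q * Q - P * P) ≡⟨ odd-identity P Q ⟩
        (+ 6 * Q - P) * (+ 6 * Q - P) - Q * Q                           ≡⟨ cong (λ x → x * x - Q * Q) (B-next n) ⟨
        + B (suc (suc n)) * + B (suc (suc n)) - Q * Q                   ∎

module NeoPellEquation where
  open import Data.List using ([]; _∷_)
  open import Data.Nat
  open import Data.Nat.Properties
  open import Data.Nat.Tactic.RingSolver using (solve)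
  open import Data.Product using (∃₂; _×_; _,_)
  open import Function.Bundles using (_⇔_; mk⇔; Equivalence)
  import Function.Properties.Equivalence as ⇔
  open import Relation.Binary.PropositionalEquality
  open import Relation.Nullary using (contradiction)
  open Squares

  -- the equation defining C^{neobc} = c, with 12 m moved across
  NeoPell : ℕ → ℕ → Set
  NeoPell m c = 8 * m * m + 9 ≡ c * c + 12 * m

  neoPell⇒Cval≡ : ∀ {m c} → NeoPell m c → Cval m ≡ c
  neoPell⇒Cval≡ {m} {c} sol = begin
    isqrt (8 * m * m + 9 ∸ 12 * m)  ≡⟨ cong (λ n → isqrt (n ∸ 12 * m)) sol ⟩
    isqrt (c * c + 12 * m ∸ 12 * m) ≡⟨ cong isqrt (m+n∸n≡m (c * c) (12 * m)) ⟩
    isqrt (c * c)                   ≡⟨ isqrt-square c ⟩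
    c                               ∎
    where open ≡-Reasoning

  ≡⇔≡-if-balanced : ∀ k .{{_ : NonZero k}} {a b c d} → a + k * d ≡ b + k * c → a ≡ b ⇔ c ≡ d
  ≡⇔≡-if-balanced k {a} {b} {c} {d} balanced = mk⇔
    (λ a≡b → sym (*-cancelˡ-≡ d c k (+-cancelˡ-≡ b _ _ (trans (cong (_+ k * d) (sym a≡b)) balanced))))
    (λ c≡d → +-cancelʳ-≡ (k * d) a b (trans balanced (cong (λ x → b + k * x) c≡d)))

  triangular-pair : ∀ k → sum1 (λ i → i) k + sum1 (λ i → i) (suc k) ≡ suc k * suc k
  triangular-pair zero = refl
  triangular-pair (suc k) = extend {sum1 (λ i → i) k} (triangular-pair k)
    where
    open ≡-Reasoning
    extend : ∀ {s s′} → s + s′ ≡ suc k * suc k →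
             (s + suc k) + (s′ + suc (suc k)) ≡ suc (suc k) * suc (suc k)
    extend {s} {s′} ih = begin
      (s + suc k) + (s′ + suc (suc k)) ≡⟨ solve (s ∷ s′ ∷ k ∷ []) ⟩
      (s + s′) + (2 * k + 3)           ≡⟨ cong (_+ (2 * k + 3)) ih ⟩
      suc k * suc k + (2 * k + 3)      ≡⟨ solve (k ∷ []) ⟩
      suc (suc k) * suc (suc k)        ∎

  arithmetic-sum : ∀ a n → 2 * sum0 (λ k → a + k) n + n ≡ n * (2 * a + n)
  arithmetic-sum a zero = refl
  arithmetic-sum a (suc n) = extend {sum0 (λ k → a + k) n} (arithmetic-sum a n)
    where
    open ≡-Reasoning
    extend : ∀ {s} → 2 * s + n ≡ n * (2 * a + n) → 2 * (s + (a + n)) + suc n ≡ suc n * (2 * a + suc n)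
    extend {s} ih = begin
      2 * (s + (a + n)) + suc n             ≡⟨ solve (s ∷ a ∷ n ∷ []) ⟩
      (2 * s + n) + (2 * a + 2 * n + 1)     ≡⟨ cong (_+ (2 * a + 2 * n + 1)) ih ⟩
      n * (2 * a + n) + (2 * a + 2 * n + 1) ≡⟨ solve (a ∷ n ∷ []) ⟩
      suc n * (2 * a + suc n)               ∎

  neoBalcoEq⇔neoPell : ∀ {m} r → 1 ≤ m → NeoBalcoEq m r ⇔ NeoPell m (2 * r + (2 * m + 1))
  neoBalcoEq⇔neoPell {suc k} r _ = ⇔.trans quadratic (⇔.sym (≡⇔≡-if-balanced 4 identity))
    where
    triangles = triangular-pair k
    trapezium = arithmetic-sum k (r + 2)
    quadratic : NeoBalcoEq (suc k) r ⇔ suc k * suc k + (r + 2) ≡ (r + 2) * (2 * k + (r + 2))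
    quadratic = mk⇔
      (λ eq → trans (cong (_+ (r + 2)) (trans (sym triangles) eq)) trapezium)
      (λ eq → trans triangles (+-cancelʳ-≡ (r + 2) _ _ (trans eq (sym trapezium))))
    identity : 8 * suc k * suc k + 9 + 4 * ((r + 2) * (2 * k + (r + 2)))
             ≡ (2 * r + (2 * suc k + 1)) * (2 * r + (2 * suc k + 1)) + 12 * suc k
               + 4 * (suc k * suc k + (r + 2))
    identity = solve (k ∷ r ∷ [])

  -- (m′ , c′) ↦ (17 m′ + 6 c′ − 12 , 48 m′ + 17 c′ − 36) is the automorphism
  -- (x , y) ↦ (17 x + 24 y , 12 x + 17 y) of x² − 2 y² written in m = (x + 3) / 4 and c = y.
  record NeoStep (m′ c′ m c : ℕ) : Set where
    constructor neoStep
    field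
      m-step : 17 * m′ + 6 * c′ ≡ m + 12
      c-step : 48 * m′ + 17 * c′ ≡ c + 36

  -- NeoPell (a ∸ 12) (b ∸ 36), with both subtractions moved across
  NeoPellShifted : ℕ → ℕ → Set
  NeoPellShifted a b = 8 * a * a + 72 * b + 9 ≡ b * b + 204 * a

  neoPell⇔shifted : ∀ m c → NeoPell m c ⇔ NeoPellShifted (m + 12) (c + 36)
  neoPell⇔shifted m c = ≡⇔≡-if-balanced 1 identity
    where
    identity : 8 * m * m + 9 + 1 * ((c + 36) * (c + 36) + 204 * (m + 12))
             ≡ c * c + 12 * m + 1 * (8 * (m + 12) * (m + 12) + 72 * (c + 36) + 9)
    identity = solve (m ∷ c ∷ [])

  neoPell⇔shifted-step : ∀ m c → NeoPell m c ⇔ NeoPellShifted (17 * m + 6 * c) (48 * m + 17 * c)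
  neoPell⇔shifted-step m c = ≡⇔≡-if-balanced 1 identity
    where
    identity : 8 * m * m + 9 + 1 * ((48 * m + 17 * c) * (48 * m + 17 * c) + 204 * (17 * m + 6 * c))
             ≡ c * c + 12 * m + 1 * (8 * (17 * m + 6 * c) * (17 * m + 6 * c) + 72 * (48 * m + 17 * c) + 9)
    identity = solve (m ∷ c ∷ [])

  neoStep-preserves : ∀ {m′ c′ m c} → NeoStep m′ c′ m c → NeoPell m′ c′ ⇔ NeoPell m c
  neoStep-preserves {m′} {c′} {m} {c} (neoStep m≡ c≡) = mk⇔
    (λ sol′ → from (neoPell⇔shifted m c)
                (subst₂ NeoPellShifted m≡ c≡ (to (neoPell⇔shifted-step m′ c′) sol′)))
    (λ sol → from (neoPell⇔shifted-step m′ c′)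
               (subst₂ NeoPellShifted (sym m≡) (sym c≡) (to (neoPell⇔shifted m c) sol)))
    where open Equivalence

  neoStep-functional : ∀ {m′ c′ m₁ c₁ m₂ c₂} →
                       NeoStep m′ c′ m₁ c₁ → NeoStep m′ c′ m₂ c₂ → m₁ ≡ m₂ × c₁ ≡ c₂
  neoStep-functional (neoStep m≡₁ c≡₁) (neoStep m≡₂ c≡₂) =
    +-cancelʳ-≡ 12 _ _ (trans (sym m≡₁) m≡₂) , +-cancelʳ-≡ 36 _ _ (trans (sym c≡₁) c≡₂)

  neoStep-increasing : ∀ {m′ c′ m c} → 3 ≤ c′ → NeoStep m′ c′ m c → m′ < m
  neoStep-increasing {m′} {c′} {m} 3≤c′ (neoStep m≡ _) = +-cancelʳ-< 12 m′ m (begin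
    suc (m′ + 12)                 ≤⟨ m≤m+n _ (16 * m′ + 5) ⟩
    suc (m′ + 12) + (16 * m′ + 5) ≡⟨ solve (m′ ∷ []) ⟩
    17 * m′ + 6 * 3               ≤⟨ +-monoʳ-≤ (17 * m′) (*-monoʳ-≤ 6 3≤c′) ⟩
    17 * m′ + 6 * c′              ≡⟨ m≡ ⟩
    m + 12                        ∎)
    where open ≤-Reasoning

  inverse⇒neoStep : ∀ {m′ c′ m c} → m′ + (6 * c + 12) ≡ 17 * m → c′ + 48 * m ≡ 17 * c + 36 →
                    NeoStep m′ c′ m c
  inverse⇒neoStep {m′} {c′} {m} {c} m′≡ c′≡ = neoStep
      (+-cancelʳ-≡ (288 * m + 102 * c + 204) (17 * m′ + 6 * c′) (m + 12) (begin
        17 * m′ + 6 * c′ + (288 * m + 102 * c + 204) ≡⟨ solve (m′ ∷ c′ ∷ m ∷ c ∷ []) ⟩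
        17 * (m′ + (6 * c + 12)) + 6 * (c′ + 48 * m) ≡⟨ cong₂ (λ u v → 17 * u + 6 * v) m′≡ c′≡ ⟩
        17 * (17 * m) + 6 * (17 * c + 36)            ≡⟨ solve (m ∷ c ∷ []) ⟩
        m + 12 + (288 * m + 102 * c + 204)           ∎))
      (+-cancelʳ-≡ (816 * m + 288 * c + 576) (48 * m′ + 17 * c′) (c + 36) (begin
        48 * m′ + 17 * c′ + (816 * m + 288 * c + 576) ≡⟨ solve (m′ ∷ c′ ∷ m ∷ c ∷ []) ⟩
        48 * (m′ + (6 * c + 12)) + 17 * (c′ + 48 * m) ≡⟨ cong₂ (λ u v → 48 * u + 17 * v) m′≡ c′≡ ⟩
        48 * (17 * m) + 17 * (17 * c + 36)            ≡⟨ solve (m ∷ c ∷ []) ⟩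
        c + 36 + (816 * m + 288 * c + 576)            ∎))
    where open ≡-Reasoning

  neoPell-suc : ∀ {k c} → NeoPell (suc k) c → c * c ≡ 8 * k * k + 4 * k + 5
  neoPell-suc {k} {c} sol = +-cancelʳ-≡ (12 * suc k) (c * c) (8 * k * k + 4 * k + 5) (trans (sym sol) identity)
    where
    identity : 8 * suc k * suc k + 9 ≡ 8 * k * k + 4 * k + 5 + 12 * suc k
    identity = solve (k ∷ [])

  neoPell-small : ∀ {m c} → NeoPell m c → m < 6 → m ≡ 0
  neoPell-small {0} _ _ = refl
  neoPell-small {1} {c} sol _ = contradiction (neoPell-suc {0} {c} sol) (not-square 2 c _ _)
  neoPell-small {2} {c} sol _ = contradiction (neoPell-suc {1} {c} sol) (not-square 4 c _ _)
  neoPell-small {3} {c} sol _ = contradiction (neoPell-suc {2} {c} sol) (not-square 6 c _ _)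
  neoPell-small {4} {c} sol _ = contradiction (neoPell-suc {3} {c} sol) (not-square 9 c _ _)
  neoPell-small {5} {c} sol _ = contradiction (neoPell-suc {4} {c} sol) (not-square 12 c _ _)
  neoPell-small {suc (suc (suc (suc (suc (suc _)))))} _ (s≤s (s≤s (s≤s (s≤s (s≤s (s≤s ()))))))

  48k+12≤17c : ∀ k c → c * c ≡ 8 * k * k + 4 * k + 5 → 48 * k + 12 ≤ 17 * c
  48k+12≤17c k c c² = square-≤⇒≤ (48 * k + 12) (17 * c) (begin
    (48 * k + 12) * (48 * k + 12)                               ≤⟨ m≤m+n _ (8 * k * k + 4 * k + 1301) ⟩
    (48 * k + 12) * (48 * k + 12) + (8 * k * k + 4 * k + 1301) ≡⟨ solve (k ∷ []) ⟩
    289 * (8 * k * k + 4 * k + 5)                               ≡⟨ cong (289 *_) c² ⟨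
    289 * (c * c)                                               ≡⟨ solve (c ∷ []) ⟩
    17 * c * (17 * c)                                           ∎)
    where open ≤-Reasoning

  6c≤17k+5 : ∀ k c → 5 ≤ k → c * c ≡ 8 * k * k + 4 * k + 5 → 6 * c ≤ 17 * k + 5
  6c≤17k+5 k c k≥5 c² = square-≤⇒≤ (6 * c) (17 * k + 5) (begin
    6 * c * (6 * c)                               ≡⟨ solve (c ∷ []) ⟩
    36 * (c * c)                                  ≡⟨ cong (36 *_) c² ⟩
    36 * (8 * k * k + 4 * k + 5)                  ≡⟨ solve (k ∷ []) ⟩
    288 * k * k + 144 * k + 25 + (5 * 5 + 26 * 5) ≤⟨ +-monoʳ-≤ (288 * k * k + 144 * k + 25)
                                                       (+-mono-≤ (*-mono-≤ k≥5 k≥5) (*-monoʳ-≤ 26 k≥5)) ⟩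
    288 * k * k + 144 * k + 25 + (k * k + 26 * k) ≡⟨ solve (k ∷ []) ⟩
    (17 * k + 5) * (17 * k + 5)                   ∎)
    where open ≤-Reasoning

  8k+3≤3c : ∀ k c → 2 ≤ k → c * c ≡ 8 * k * k + 4 * k + 5 → 8 * k + 3 ≤ 3 * c
  8k+3≤3c k c k≥2 c² = square-≤⇒≤ (8 * k + 3) (3 * c) (begin
    (8 * k + 3) * (8 * k + 3)                              ≡⟨ solve (k ∷ []) ⟩
    64 * k * k + 36 * k + 9 + 6 * 2 * k                    ≤⟨ +-monoʳ-≤ (64 * k * k + 36 * k + 9)
                                                                (*-monoˡ-≤ k (*-monoʳ-≤ 6 k≥2)) ⟩
    64 * k * k + 36 * k + 9 + 6 * k * k                    ≤⟨ m≤m+n _ (2 * k * k + 36) ⟩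
    64 * k * k + 36 * k + 9 + 6 * k * k + (2 * k * k + 36) ≡⟨ solve (k ∷ []) ⟩
    9 * (8 * k * k + 4 * k + 5)                            ≡⟨ cong (9 *_) c² ⟨
    9 * (c * c)                                            ≡⟨ solve (c ∷ []) ⟩
    3 * c * (3 * c)                                        ∎)
    where open ≤-Reasoning

  neoPell-descent : ∀ {m c} → NeoPell m c → 6 ≤ m →
                    ∃₂ λ m′ c′ → m′ < m × NeoPell m′ c′ × NeoStep m′ c′ m c
  neoPell-descent {suc k} {c} sol (s≤s k≥5) =
    m′ , c′ , m′<m , Equivalence.from (neoStep-preserves step) sol , step
    where
    open ≤-Reasoning
    c² = neoPell-suc {k} {c} sol
    m′ = 17 * suc k ∸ (6 * c + 12)
    c′ = 17 * c + 36 ∸ 48 * suc k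
    6c+12≤17m : 6 * c + 12 ≤ 17 * suc k
    6c+12≤17m = begin
      6 * c + 12      ≤⟨ +-monoˡ-≤ 12 (6c≤17k+5 k c k≥5 c²) ⟩
      17 * k + 5 + 12 ≡⟨ solve (k ∷ []) ⟩
      17 * suc k      ∎
    48m≤17c+36 : 48 * suc k ≤ 17 * c + 36
    48m≤17c+36 = begin
      48 * suc k       ≡⟨ solve (k ∷ []) ⟩
      48 * k + 12 + 36 ≤⟨ +-monoˡ-≤ 36 (48k+12≤17c k c c²) ⟩
      17 * c + 36      ∎
    m′-inverse : m′ + (6 * c + 12) ≡ 17 * suc k
    m′-inverse = m∸n+n≡m 6c+12≤17m
    step : NeoStep m′ c′ (suc k) c
    step = inverse⇒neoStep m′-inverse (m∸n+n≡m 48m≤17c+36)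
    c-large : 8 * k + 3 ≤ 3 * c
    c-large = 8k+3≤3c k c (≤-trans (s≤s (s≤s z≤n)) k≥5) c²
    m′<m : m′ < suc k
    m′<m = +-cancelʳ-< (6 * c + 12) m′ (suc k) (begin-strict
      m′ + (6 * c + 12)              ≡⟨ m′-inverse ⟩
      17 * suc k                     <⟨ n<1+n _ ⟩
      suc (17 * suc k)               ≡⟨ solve (k ∷ []) ⟩
      suc k + (11 + 2 * (8 * k + 3)) ≤⟨ +-monoʳ-≤ (suc k) (+-monoʳ-≤ 11 (*-monoʳ-≤ 2 c-large)) ⟩
      suc k + (11 + 2 * (3 * c))     <⟨ +-monoʳ-< (suc k) (n<1+n _) ⟩
      suc k + (12 + 2 * (3 * c))     ≡⟨ solve (k ∷ c ∷ []) ⟩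
      suc k + (6 * c + 12)           ∎)

module NeoBalcobalancingSequences where
  open import Data.Nat

  -- The closed forms of B_n^{neobc}, R_n^{neobc} and C_n^{neobc}. At n = 0 (where pred 0 = 0)
  -- they give the trivial solution m = 0, c = 3 of c² = 8 m² − 12 m + 9.
  neoB : ℕ → ℕ
  neoB n = 6 * B n * (B n ∸ B (pred n))

  neoR : ℕ → ℕ
  neoR n = suc (12 * B (pred n) * B n)

  neoC : ℕ → ℕ
  neoC n = 2 * neoR n + (2 * neoB n + 1)

module NeoBalcobalancingIdentities where
  open import Data.Integer using (ℤ; +_; _+_; _-_; _*_; -_)
  import Data.Integer.Properties as ℤ
  open import Data.Integer.Tactic.RingSolver using (solve-∀)
  open import Data.Nat as ℕ using (ℕ; zero; suc)
  import Data.Nat.Properties as ℕ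
  open import Relation.Binary.PropositionalEquality
  open BalancingNumbers
  open NeoBalcobalancingSequences
  open NeoPellEquation using (NeoStep; neoStep)

  module _ (j : ℕ) where
    private
      P = + B j
      Q = + B (suc j)

    neoB-ℤ : + neoB (suc j) ≡ + 6 * Q * (Q - P)
    neoB-ℤ = trans (ℤ.pos-* (6 ℕ.* B (suc j)) (B (suc j) ℕ.∸ B j))
                   (cong₂ _*_ (ℤ.pos-* 6 (B (suc j))) (pos-∸ (B-mono j)))

    neoR-ℤ : + neoR (suc j) ≡ + 1 + + 12 * P * Q
    neoR-ℤ = trans (ℤ.pos-+ 1 (12 ℕ.* B j ℕ.* B (suc j)))
                   (cong (λ x → + 1 + x) (trans (ℤ.pos-* (12 ℕ.* B j) (B (suc j)))
                                                (cong (_* Q) (ℤ.pos-* 12 (B j)))))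

    neoC-ℤ : + neoC (suc j) ≡ + 2 * (+ 1 + + 12 * P * Q) + (+ 2 * (+ 6 * Q * (Q - P)) + + 1)
    neoC-ℤ = begin
      + (2 ℕ.* r ℕ.+ (2 ℕ.* b ℕ.+ 1))  ≡⟨ ℤ.pos-+ (2 ℕ.* r) (2 ℕ.* b ℕ.+ 1) ⟩
      + (2 ℕ.* r) + + (2 ℕ.* b ℕ.+ 1)  ≡⟨ cong₂ _+_ (ℤ.pos-* 2 r) (ℤ.pos-+ (2 ℕ.* b) 1) ⟩
      + 2 * + r + (+ (2 ℕ.* b) + + 1)  ≡⟨ cong₂ (λ x y → + 2 * x + (y + + 1)) neoR-ℤ
                                                 (trans (ℤ.pos-* 2 b) (cong (+ 2 *_) neoB-ℤ)) ⟩
      + 2 * (+ 1 + + 12 * P * Q) + (+ 2 * (+ 6 * Q * (Q - P)) + + 1) ∎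
      where
      open ≡-Reasoning
      r = neoR (suc j)
      b = neoB (suc j)

  neoB-step : ∀ j → 17 ℕ.* neoB (suc j) ℕ.+ 6 ℕ.* neoC (suc j) ≡ neoB (suc (suc j)) ℕ.+ 12
  neoB-step j = ℤ.+-injective (begin
    + (17 ℕ.* neoB (suc j) ℕ.+ 6 ℕ.* neoC (suc j))
      ≡⟨ pos-lin 17 (neoB (suc j)) 6 (neoC (suc j)) ⟩
    + 17 * + neoB (suc j) + + 6 * + neoC (suc j)
      ≡⟨ cong₂ (λ b c → + 17 * b + + 6 * c) (neoB-ℤ j) (neoC-ℤ j) ⟩
    + 17 * (+ 6 * Q * (Q - P)) + + 6 * (+ 2 * (+ 1 + + 12 * P * Q) + (+ 2 * (+ 6 * Q * (Q - P)) + + 1))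
      ≡⟨ ≡-by-cassini (- + 6) j (identity P Q) ⟩
    + 6 * (+ 6 * Q - P) * ((+ 6 * Q - P) - Q) + + 12
      ≡⟨ cong (λ Q′ → + 6 * Q′ * (Q′ - Q) + + 12) (B-next j) ⟨
    + 6 * Q″ * (Q″ - Q) + + 12
      ≡⟨ cong (_+ + 12) (neoB-ℤ (suc j)) ⟨
    + neoB (suc (suc j)) + + 12
      ≡⟨ ℤ.pos-+ (neoB (suc (suc j))) 12 ⟨
    + (neoB (suc (suc j)) ℕ.+ 12) ∎)
    where
    open ≡-Reasoning
    P = + B j
    Q = + B (suc j)
    Q″ = + B (suc (suc j))
    identity : ∀ P Q →
      + 17 * (+ 6 * Q * (Q - P)) + + 6 * (+ 2 * (+ 1 + + 12 * P * Q) + (+ 2 * (+ 6 * Q * (Q - P)) + + 1))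
        - (+ 6 * (+ 6 * Q - P) * ((+ 6 * Q - P) - Q) + + 12)
      ≡ - + 6 * (Q * Q + P * P - (+ 6 * P * Q + + 1))
    identity = solve-∀

  neoC-step : ∀ j → 48 ℕ.* neoB (suc j) ℕ.+ 17 ℕ.* neoC (suc j) ≡ neoC (suc (suc j)) ℕ.+ 36
  neoC-step j = ℤ.+-injective (begin
    + (48 ℕ.* neoB (suc j) ℕ.+ 17 ℕ.* neoC (suc j))
      ≡⟨ pos-lin 48 (neoB (suc j)) 17 (neoC (suc j)) ⟩
    + 48 * + neoB (suc j) + + 17 * + neoC (suc j)
      ≡⟨ cong₂ (λ b c → + 48 * b + + 17 * c) (neoB-ℤ j) (neoC-ℤ j) ⟩
    + 48 * (+ 6 * Q * (Q - P)) + + 17 * (+ 2 * (+ 1 + + 12 * P * Q) + (+ 2 * (+ 6 * Q * (Q - P)) + + 1))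
      ≡⟨ ≡-by-cassini (- + 12) j (identity P Q) ⟩
    + 2 * (+ 1 + + 12 * Q * (+ 6 * Q - P)) + (+ 2 * (+ 6 * (+ 6 * Q - P) * ((+ 6 * Q - P) - Q)) + + 1) + + 36
      ≡⟨ cong (λ Q′ → + 2 * (+ 1 + + 12 * Q * Q′) + (+ 2 * (+ 6 * Q′ * (Q′ - Q)) + + 1) + + 36) (B-next j) ⟨
    + 2 * (+ 1 + + 12 * Q * Q″) + (+ 2 * (+ 6 * Q″ * (Q″ - Q)) + + 1) + + 36
      ≡⟨ cong (_+ + 36) (neoC-ℤ (suc j)) ⟨
    + neoC (suc (suc j)) + + 36
      ≡⟨ ℤ.pos-+ (neoC (suc (suc j))) 36 ⟨
    + (neoC (suc (suc j)) ℕ.+ 36) ∎)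
    where
    open ≡-Reasoning
    P = + B j
    Q = + B (suc j)
    Q″ = + B (suc (suc j))
    identity : ∀ P Q →
      + 48 * (+ 6 * Q * (Q - P)) + + 17 * (+ 2 * (+ 1 + + 12 * P * Q) + (+ 2 * (+ 6 * Q * (Q - P)) + + 1))
        - (+ 2 * (+ 1 + + 12 * Q * (+ 6 * Q - P)) + (+ 2 * (+ 6 * (+ 6 * Q - P) * ((+ 6 * Q - P) - Q)) + + 1) + + 36)
      ≡ - + 12 * (Q * Q + P * P - (+ 6 * P * Q + + 1))
    identity = solve-∀

  neoStep-neoB : ∀ n → NeoStep (neoB n) (neoC n) (neoB (suc n)) (neoC (suc n))
  neoStep-neoB zero = neoStep refl refl
  neoStep-neoB (suc j) = neoStep (neoB-step j) (neoC-step j)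

  CRval-neoR : ∀ j → + CRval (neoR (suc j)) ≡ + 3 * (+ B (suc j) * + B (suc j) - + B j * + B j)
  CRval-neoR j = begin
    + CRval r             ≡⟨ cong (λ n → + isqrt n) (ℤ.+-injective w²≡) ⟨
    + isqrt (w ℕ.* w)     ≡⟨ cong +_ (Squares.isqrt-square w) ⟩
    + w                   ≡⟨ w-ℤ ⟩
    + 3 * (Q * Q - P * P) ∎
    where
    open ≡-Reasoning
    P = + B j
    Q = + B (suc j)
    r = neoR (suc j)
    w = 3 ℕ.* (B (suc j) ℕ.* B (suc j) ℕ.∸ B j ℕ.* B j)
    w-ℤ : + w ≡ + 3 * (Q * Q - P * P)
    w-ℤ = trans (ℤ.pos-* 3 (B (suc j) ℕ.* B (suc j) ℕ.∸ B j ℕ.* B j))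
                (cong (+ 3 *_) (trans (pos-∸ (ℕ.*-mono-≤ (B-mono j) (B-mono j)))
                                      (cong₂ _-_ (ℤ.pos-* (B (suc j)) (B (suc j))) (ℤ.pos-* (B j) (B j)))))
    identity : ∀ P Q → + 3 * (Q * Q - P * P) * (+ 3 * (Q * Q - P * P))
                       - (+ 2 * (+ 1 + + 12 * P * Q) * (+ 1 + + 12 * P * Q) + + 5 * (+ 1 + + 12 * P * Q) + + 2)
                     ≡ + 9 * (Q * Q + P * P + + 6 * P * Q + + 1) * (Q * Q + P * P - (+ 6 * P * Q + + 1))
    identity = solve-∀
    w²≡ : + (w ℕ.* w) ≡ + (2 ℕ.* r ℕ.* r ℕ.+ 5 ℕ.* r ℕ.+ 2)
    w²≡ = begin
      + (w ℕ.* w)                         ≡⟨ trans (ℤ.pos-* w w) (cong₂ _*_ w-ℤ w-ℤ) ⟩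
      + 3 * (Q * Q - P * P) * (+ 3 * (Q * Q - P * P))
        ≡⟨ ≡-by-cassini (+ 9 * (Q * Q + P * P + + 6 * P * Q + + 1)) j (identity P Q) ⟩
      + 2 * (+ 1 + + 12 * P * Q) * (+ 1 + + 12 * P * Q) + + 5 * (+ 1 + + 12 * P * Q) + + 2
        ≡⟨ cong (λ x → + 2 * x * x + + 5 * x + + 2) (neoR-ℤ j) ⟨
      + 2 * + r * + r + + 5 * + r + + 2   ≡⟨ cong (λ x → x * + r + + 5 * + r + + 2) (ℤ.pos-* 2 r) ⟨
      + (2 ℕ.* r) * + r + + 5 * + r + + 2 ≡⟨ cong (_+ + 2) (pos-lin (2 ℕ.* r) r 5 r) ⟨
      + (2 ℕ.* r ℕ.* r ℕ.+ 5 ℕ.* r) + + 2 ≡⟨ ℤ.pos-+ (2 ℕ.* r ℕ.* r ℕ.+ 5 ℕ.* r) 2 ⟨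
      + (2 ℕ.* r ℕ.* r ℕ.+ 5 ℕ.* r ℕ.+ 2) ∎

  telescope : ∀ (f : ℕ → ℕ) K (G : ℕ → ℤ) → G 0 ≡ + 0 →
              (∀ n → G n + K * + f (suc n) ≡ G (suc n)) → ∀ n → K * + sum1 f n ≡ G n
  telescope f K G G₀ step zero = trans (ℤ.*-zeroʳ K) (sym G₀)
  telescope f K G G₀ step (suc n) = begin
    K * + (sum1 f n ℕ.+ f (suc n))   ≡⟨ cong (K *_) (ℤ.pos-+ (sum1 f n) (f (suc n))) ⟩
    K * (+ sum1 f n + + f (suc n))   ≡⟨ ℤ.*-distribˡ-+ K (+ sum1 f n) (+ f (suc n)) ⟩
    K * + sum1 f n + K * + f (suc n) ≡⟨ cong (_+ K * + f (suc n)) (telescope f K G G₀ step n) ⟩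
    G n + K * + f (suc n)            ≡⟨ step n ⟩
    G (suc n)                        ∎
    where open ≡-Reasoning

  sum-neoB : ∀ n → + 4 * + sum1 neoB n
                   ≡ + 21 * + B n * + B n - + 3 * + B n * + B (suc n) + + 3 * + B (2 ℕ.* n) + + 3 * + n
  sum-neoB n = begin
    + 4 * + sum1 neoB n ≡⟨ telescope neoB (+ 4) G refl step n ⟩
    G n                 ≡⟨ closed-form (+ B n) (+ B (suc n)) (+ n) ⟩
    + 21 * + B n * + B n - + 3 * + B n * + B (suc n) + + 3 * (+ 2 * + B n * + B (suc n) - + 6 * + B n * + B n) + + 3 * + n
      ≡⟨ cong (λ d → + 21 * + B n * + B n - + 3 * + B n * + B (suc n) + + 3 * d + + 3 * + n) (B-double n) ⟨
    + 21 * + B n * + B n - + 3 * + B n * + B (suc n) + + 3 * + B (2 ℕ.* n) + + 3 * + n ∎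
    where
    open ≡-Reasoning
    G : ℕ → ℤ
    G n = + 3 * + B n * + B n + + 3 * + B n * + B (suc n) + + 3 * + n
    closed-form : ∀ P Q N → + 3 * P * P + + 3 * P * Q + + 3 * N
                          ≡ + 21 * P * P - + 3 * P * Q + + 3 * (+ 2 * P * Q - + 6 * P * P) + + 3 * N
    closed-form = solve-∀
    step-identity : ∀ P Q N → + 3 * P * P + + 3 * P * Q + + 3 * N + + 4 * (+ 6 * Q * (Q - P))
                              - (+ 3 * Q * Q + + 3 * Q * (+ 6 * Q - P) + + 3 * (+ 1 + N))
                            ≡ + 3 * (Q * Q + P * P - (+ 6 * P * Q + + 1))
    step-identity = solve-∀
    step : ∀ n → G n + + 4 * + neoB (suc n) ≡ G (suc n)
    step n = begin
      G n + + 4 * + neoB (suc n)      ≡⟨ cong (λ b → G n + + 4 * b) (neoB-ℤ n) ⟩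
      G n + + 4 * (+ 6 * Q * (Q - P)) ≡⟨ ≡-by-cassini (+ 3) n (step-identity P Q (+ n)) ⟩
      + 3 * Q * Q + + 3 * Q * (+ 6 * Q - P) + + 3 * (+ 1 + + n)
        ≡⟨ cong₂ (λ Q′ m → + 3 * Q * Q + + 3 * Q * Q′ + + 3 * m) (B-next n) (ℤ.pos-+ 1 n) ⟨
      G (suc n)                       ∎
      where
      P = + B n
      Q = + B (suc n)

  sum-neoC : ∀ n → + sum1 neoC n ≡ + 15 * + B n * + B n - + 3 * + B n * + B (suc n) + + 3 * + B (2 ℕ.* n)
  sum-neoC n = begin
    + sum1 neoC n       ≡⟨ ℤ.*-identityˡ (+ sum1 neoC n) ⟨
    + 1 * + sum1 neoC n ≡⟨ telescope neoC (+ 1) G refl step n ⟩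
    G n                 ≡⟨ closed-form (+ B n) (+ B (suc n)) ⟩
    + 15 * + B n * + B n - + 3 * + B n * + B (suc n) + + 3 * (+ 2 * + B n * + B (suc n) - + 6 * + B n * + B n)
      ≡⟨ cong (λ d → + 15 * + B n * + B n - + 3 * + B n * + B (suc n) + + 3 * d) (B-double n) ⟨
    + 15 * + B n * + B n - + 3 * + B n * + B (suc n) + + 3 * + B (2 ℕ.* n) ∎
    where
    open ≡-Reasoning
    G : ℕ → ℤ
    G n = + 3 * + B n * + B (suc n) - + 3 * + B n * + B n
    closed-form : ∀ P Q → + 3 * P * Q - + 3 * P * P
                        ≡ + 15 * P * P - + 3 * P * Q + + 3 * (+ 2 * P * Q - + 6 * P * P)
    closed-form = solve-∀
    step-identity : ∀ P Q → + 3 * P * Q - + 3 * P * P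
                              + + 1 * (+ 2 * (+ 1 + + 12 * P * Q) + (+ 2 * (+ 6 * Q * (Q - P)) + + 1))
                            - (+ 3 * Q * (+ 6 * Q - P) - + 3 * Q * Q)
                          ≡ - + 3 * (Q * Q + P * P - (+ 6 * P * Q + + 1))
    step-identity = solve-∀
    step : ∀ n → G n + + 1 * + neoC (suc n) ≡ G (suc n)
    step n = begin
      G n + + 1 * + neoC (suc n)
        ≡⟨ cong (λ c → G n + + 1 * c) (neoC-ℤ n) ⟩
      G n + + 1 * (+ 2 * (+ 1 + + 12 * P * Q) + (+ 2 * (+ 6 * Q * (Q - P)) + + 1))
        ≡⟨ ≡-by-cassini (- + 3) n (step-identity P Q) ⟩
      + 3 * Q * (+ 6 * Q - P) - + 3 * Q * Q
        ≡⟨ cong (λ Q′ → + 3 * Q * Q′ - + 3 * Q * Q) (B-next n) ⟨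
      G (suc n) ∎
      where
      P = + B n
      Q = + B (suc n)

  sum-neoR : ∀ n → + 4 * + sum1 neoR n
                   ≡ + 9 * + B n * + B n - + 3 * + B n * + B (suc n) + + 3 * + B (2 ℕ.* n) - + 5 * + n
  sum-neoR n = begin
    + 4 * + sum1 neoR n ≡⟨ telescope neoR (+ 4) G refl step n ⟩
    G n                 ≡⟨ closed-form (+ B n) (+ B (suc n)) (+ n) ⟩
    + 9 * + B n * + B n - + 3 * + B n * + B (suc n) + + 3 * (+ 2 * + B n * + B (suc n) - + 6 * + B n * + B n) - + 5 * + n
      ≡⟨ cong (λ d → + 9 * + B n * + B n - + 3 * + B n * + B (suc n) + + 3 * d - + 5 * + n) (B-double n) ⟨
    + 9 * + B n * + B n - + 3 * + B n * + B (suc n) + + 3 * + B (2 ℕ.* n) - + 5 * + n ∎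
    where
    open ≡-Reasoning
    G : ℕ → ℤ
    G n = + 3 * + B n * + B (suc n) - + 9 * + B n * + B n - + 5 * + n
    closed-form : ∀ P Q N → + 3 * P * Q - + 9 * P * P - + 5 * N
                          ≡ + 9 * P * P - + 3 * P * Q + + 3 * (+ 2 * P * Q - + 6 * P * P) - + 5 * N
    closed-form = solve-∀
    step-identity : ∀ P Q N → + 3 * P * Q - + 9 * P * P - + 5 * N + + 4 * (+ 1 + + 12 * P * Q)
                              - (+ 3 * Q * (+ 6 * Q - P) - + 9 * Q * Q - + 5 * (+ 1 + N))
                            ≡ - + 9 * (Q * Q + P * P - (+ 6 * P * Q + + 1))
    step-identity = solve-∀
    step : ∀ n → G n + + 4 * + neoR (suc n) ≡ G (suc n)
    step n = begin
      G n + + 4 * + neoR (suc n)       ≡⟨ cong (λ r → G n + + 4 * r) (neoR-ℤ n) ⟩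
      G n + + 4 * (+ 1 + + 12 * P * Q) ≡⟨ ≡-by-cassini (- + 9) n (step-identity P Q (+ n)) ⟩
      + 3 * Q * (+ 6 * Q - P) - + 9 * Q * Q - + 5 * (+ 1 + + n)
        ≡⟨ cong₂ (λ Q′ m → + 3 * Q * Q′ - + 9 * Q * Q - + 5 * m) (B-next n) (ℤ.pos-+ 1 n) ⟨
      G (suc n)                        ∎
      where
      P = + B n
      Q = + B (suc n)

  sum-CRval-neoR : ∀ n → sum1 (λ i → CRval (neoR i)) n ≡ 3 ℕ.* B n ℕ.* B n
  sum-CRval-neoR n = ℤ.+-injective (begin
    + sum1 f n            ≡⟨ ℤ.*-identityˡ (+ sum1 f n) ⟨
    + 1 * + sum1 f n      ≡⟨ telescope f (+ 1) G refl step n ⟩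
    + 3 * + B n * + B n   ≡⟨ cong (_* + B n) (ℤ.pos-* 3 (B n)) ⟨
    + (3 ℕ.* B n) * + B n ≡⟨ ℤ.pos-* (3 ℕ.* B n) (B n) ⟨
    + (3 ℕ.* B n ℕ.* B n) ∎)
    where
    open ≡-Reasoning
    f : ℕ → ℕ
    f i = CRval (neoR i)
    G : ℕ → ℤ
    G n = + 3 * + B n * + B n
    step-identity : ∀ P Q → + 3 * P * P + + 1 * (+ 3 * (Q * Q - P * P)) ≡ + 3 * Q * Q
    step-identity = solve-∀
    step : ∀ n → G n + + 1 * + f (suc n) ≡ G (suc n)
    step n = trans (cong (λ w → G n + + 1 * w) (CRval-neoR n)) (step-identity (+ B n) (+ B (suc n)))

module IncreasingSequences where
  open import Data.Nat
  open import Data.Nat.Induction using (<-rec)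
  open import Data.Nat.Properties
  open import Data.Product using (∃-syntax; _,_)
  open import Relation.Binary.PropositionalEquality
  open import Relation.Nullary using (¬_; yes; no)

  Increasing : (ℕ → ℕ) → Set
  Increasing a = ∀ i → a i < a (suc i)

  module _ {a : ℕ → ℕ} (a↑ : Increasing a) where

    increasing⇒≤-mono : ∀ {i j} → i ≤ j → a i ≤ a j
    increasing⇒≤-mono i≤j = from-≤′ (≤⇒≤′ i≤j)
      where
      from-≤′ : ∀ {i j} → i ≤′ j → a i ≤ a j
      from-≤′ ≤′-refl = ≤-refl
      from-≤′ (≤′-step i≤′j) = ≤-trans (from-≤′ i≤′j) (<⇒≤ (a↑ _))

    increasing⇒<-mono : ∀ {i j} → i < j → a i < a j
    increasing⇒<-mono {i} i<j = <-≤-trans (a↑ i) (increasing⇒≤-mono i<j)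

  -- a n = b j for some j: if j < n then a n = b j = a j, otherwise b n ≤ b j = a n.
  private
    not-below : ∀ {a b} → Increasing a → Increasing b → (∀ i → ∃[ j ] b j ≡ a i) →
                ∀ n → (∀ {m} → m < n → a m ≡ b m) → ¬ (a n < b n)
    not-below {a} {b} a↑ b↑ a⊆b n agree an<bn with a⊆b n
    ... | j , bj≡an with j <? n
    ...   | yes j<n = <-irrefl (trans (agree j<n) bj≡an) (increasing⇒<-mono a↑ j<n)
    ...   | no  j≮n = <-irrefl refl
                        (≤-<-trans (≤-trans (increasing⇒≤-mono b↑ (≮⇒≥ j≮n)) (≤-reflexive bj≡an)) an<bn)

  increasing-same-range⇒≡ : ∀ {a b} → Increasing a → Increasing b →
                            (∀ i → ∃[ j ] b j ≡ a i) → (∀ i → ∃[ j ] a j ≡ b i) → ∀ n → a n ≡ b n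
  increasing-same-range⇒≡ {a} {b} a↑ b↑ a⊆b b⊆a = <-rec _ λ n agree →
    ≤-antisym (≮⇒≥ (not-below b↑ a↑ b⊆a n (λ m<n → sym (agree m<n))))
              (≮⇒≥ (not-below a↑ b↑ a⊆b n agree))

module NeoBalcobalancingEnumeration where
  open import Data.Nat
  open import Data.Nat.DivMod using (_/_; m*n/n≡m)
  open import Data.Nat.Induction using (<-rec)
  open import Data.Nat.Properties
  open import Data.Product using (∃-syntax; _×_; _,_)
  open import Function.Bundles using (mk⇔; Equivalence)
  open import Relation.Binary.PropositionalEquality
  open import Relation.Nullary using (yes; no; contradiction)
  open Squares using (square-injective)
  open NeoPellEquation
  open NeoBalcobalancingSequences
  open NeoBalcobalancingIdentities using (neoStep-neoB)
  open IncreasingSequences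

  neoPell-neoB : ∀ n → NeoPell (neoB n) (neoC n)
  neoPell-neoB zero = refl
  neoPell-neoB (suc n) = Equivalence.to (neoStep-preserves (neoStep-neoB n)) (neoPell-neoB n)

  OnOrbit : ℕ → ℕ → Set
  OnOrbit m c = ∃[ n ] m ≡ neoB n × c ≡ neoC n

  neoPell-solutions : ∀ m {c} → NeoPell m c → OnOrbit m c
  neoPell-solutions = <-rec _ solutions
    where
    solutions : ∀ m → (∀ {m′} → m′ < m → ∀ {c′} → NeoPell m′ c′ → OnOrbit m′ c′) →
                ∀ {c} → NeoPell m c → OnOrbit m c
    solutions m smaller {c} sol with m <? 6
    ... | yes m<6 with refl ← neoPell-small {m} {c} sol m<6 =
          0 , refl , square-injective c 3 (trans (sym (+-identityʳ (c * c))) (sym sol))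
    ... | no  m≮6 with m′ , c′ , m′<m , sol′ , step ← neoPell-descent {m} {c} sol (≮⇒≥ m≮6)
                  with n , refl , refl ← smaller m′<m {c′} sol′ =
          suc n , neoStep-functional step (neoStep-neoB n)

  3≤neoC : ∀ n → 3 ≤ neoC n
  3≤neoC n = +-mono-≤ (*-monoʳ-≤ 2 {1} {neoR n} (s≤s z≤n)) (m≤n+m 1 (2 * neoB n))

  neoB-increasing : Increasing neoB
  neoB-increasing n = neoStep-increasing (3≤neoC n) (neoStep-neoB n)

  neoB-neoBC : ∀ j → NeoBC (neoB (suc j))
  neoB-neoBC j = 1≤m , neoR (suc j) , s≤s z≤n ,
                 Equivalence.from (neoBalcoEq⇔neoPell (neoR (suc j)) 1≤m) (neoPell-neoB (suc j))
    where
    1≤m = ≤-trans (s≤s z≤n) (neoB-increasing j)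

  neoBC⇒neoB : ∀ {m} → NeoBC m → ∃[ j ] neoB (suc j) ≡ m
  neoBC⇒neoB {m} (1≤m , r , _ , eq)
    with neoPell-solutions m {2 * r + (2 * m + 1)} (Equivalence.to (neoBalcoEq⇔neoPell r 1≤m) eq)
  ... | zero  , refl , _ = contradiction 1≤m λ ()
  ... | suc j , m≡ , _   = j , sym m≡

  neoB-enumerates : IsNeoBCEnum neoB
  neoB-enumerates = (λ i → neoB-increasing (suc i))
                  , λ m → mk⇔ neoBC⇒neoB (λ { (j , refl) → neoB-neoBC j })

  enumeration-unique : ∀ e → IsNeoBCEnum e → ∀ i → e (suc i) ≡ neoB (suc i)
  enumeration-unique e (e↑ , e-range) = increasing-same-range⇒≡ e↑ (λ i → neoB-increasing (suc i))
    (λ i → neoBC⇒neoB (Equivalence.from (e-range (e (suc i))) (i , refl)))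
    (λ i → Equivalence.to (e-range (neoB (suc i))) (neoB-neoBC i))

  Cval-neoB : ∀ n → Cval (neoB n) ≡ neoC n
  Cval-neoB n = neoPell⇒Cval≡ {neoB n} (neoPell-neoB n)

  Rval-neoB : ∀ n → Rval (neoB n) ≡ neoR n
  Rval-neoB n = begin
    (Cval (neoB n) ∸ (2 * neoB n + 1)) / 2  ≡⟨ cong (λ c → (c ∸ (2 * neoB n + 1)) / 2) (Cval-neoB n) ⟩
    (neoC n ∸ (2 * neoB n + 1)) / 2         ≡⟨ cong (_/ 2) (m+n∸n≡m (2 * neoR n) (2 * neoB n + 1)) ⟩
    (2 * neoR n) / 2                        ≡⟨ cong (_/ 2) (*-comm 2 (neoR n)) ⟩
    (neoR n * 2) / 2                        ≡⟨ m*n/n≡m (neoR n) 2 ⟩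
    neoR n                                  ∎
    where open ≡-Reasoning

  sum0-cong : ∀ {f g} → (∀ k → f k ≡ g k) → ∀ n → sum0 f n ≡ sum0 g n
  sum0-cong f≗g zero = refl
  sum0-cong f≗g (suc n) = cong₂ _+_ (sum0-cong f≗g n) (f≗g n)

  sum1-over-enumeration : ∀ e → IsNeoBCEnum e → ∀ (f g : ℕ → ℕ) →
                          (∀ j → f (neoB (suc j)) ≡ g (suc j)) → ∀ n → sum1 (λ i → f (e i)) n ≡ sum1 g n
  sum1-over-enumeration e e-enum f g f∘neoB≗g =
    sum0-cong (λ j → trans (cong f (enumeration-unique e e-enum j)) (f∘neoB≗g j))

open import Data.Nat using (ℕ; suc; _≤_)
open import Data.Integer using (ℤ; +_; _+_; _-_; _*_)
open import Data.Product using (Σ; _×_; _,_)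
open import Relation.Binary.PropositionalEquality using (_≡_; refl; trans; cong)
open NeoBalcobalancingSequences
open NeoBalcobalancingIdentities using (sum-neoB; sum-neoC; sum-neoR; sum-CRval-neoR)
open NeoBalcobalancingEnumeration

theorem9p1 :
    Σ (ℕ → ℕ) IsNeoBCEnum ×
    ((e : ℕ → ℕ) → IsNeoBCEnum e → (n : ℕ) → 1 ≤ n →
      (+ 4 * + sum1 e n
          ≡ + 21 * + B n * + B n - + 3 * + B n * + B (suc n) + + 3 * + B (2 Data.Nat.* n) + + 3 * + n)
      × (+ sum1 (λ i → Cval (e i)) n
          ≡ + 15 * + B n * + B n - + 3 * + B n * + B (suc n) + + 3 * + B (2 Data.Nat.* n))
      × (+ 4 * + sum1 (λ i → Rval (e i)) n
          ≡ + 9 * + B n * + B n - + 3 * + B n * + B (suc n) + + 3 * + B (2 Data.Nat.* n) - + 5 * + n)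
      × (sum1 (λ i → CRval (Rval (e i))) n ≡ 3 Data.Nat.* B n Data.Nat.* B n))
theorem9p1 = (neoB , neoB-enumerates) , λ e e-enum n _ →
  let over = sum1-over-enumeration e e-enum in
    trans (cong (λ s → + 4 * + s) (over (λ m → m) neoB (λ _ → refl) n)) (sum-neoB n)
  , trans (cong +_ (over Cval neoC (λ j → Cval-neoB (suc j)) n)) (sum-neoC n)
  , trans (cong (λ s → + 4 * + s) (over Rval neoR (λ j → Rval-neoB (suc j)) n)) (sum-neoR n)
  , trans (over (λ m → CRval (Rval m)) (λ i → CRval (neoR i)) (λ j → cong CRval (Rval-neoB (suc j))) n)
          (sum-CRval-neoR n)
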